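{- Let $\mathbf A,\mathbf B$ and $\mathbf A_i$ ($i\in I$) be De Morgan monoids, and $\mathbf S$ and $\mathbf S_i$ ($i\in I$) totally ordered odd Sugihara monoids, for a set $I$. (1) If $h\colon\mathbf A\to\mathbf B$ is a homomorphism, then the map $h'$ on $(S\setminus\{e^{\mathbf S}\})\cup A$ given by $h'(x)=h(x)$ for $x\in A$ and $h'(x)=x$ otherwise is a homomorphism from $\mathbf S[\mathbf A]$ to $\mathbf S[\mathbf B]$ extending $h$. (2) If $\mathbf P$ is a subalgebra of $\mathbf S$ and $\mathbf B$ is a subalgebra of $\mathbf A$, then $\mathbf P[\mathbf B]$ is a subalgebra of $\mathbf S[\mathbf A]$. (3) For every ultrafilter $\mathcal U$ over $I$, $\prod_{i\in I}(\mathbf S_i[\mathbf A_i])/\mathcal U\cong\big(\prod_{i\in I}\mathbf S_i/\mathcal U\big)\big[\prod_{i\in I}\mathbf A_i/\mathcal U\big]$.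
   Context: An involutive residuated lattice (IRL) is an algebra $\langle A;\cdot,\wedge,\vee,\neg,e\rangle$ with $\langle A;\cdot,e\rangle$ a commutative monoid, $\langle A;\wedge,\vee\rangle$ a lattice, $\neg\neg x=x$, and $x\cdot y\leqslant z\iff\neg z\cdot y\leqslant\neg x$; $f:=\neg e$. A De Morgan monoid is an IRL with distributive lattice satisfying $x\leqslant x\cdot x$. A Sugihara monoid is a De Morgan monoid with $a\cdot a=a$ for all $a$; odd if $f=e$. Rigorous extension: for a De Morgan monoid $\mathbf A$ and a totally ordered odd Sugihara monoid $\mathbf S$ (with disjoint universes), $\mathbf S[\mathbf A]$ is the algebra with universe $(S\setminus\{e^{\mathbf S}\})\cup A$, neutral element $e^{\mathbf A}$, whose operations $\neg$ and $\star\in\{\wedge,\vee,\cdot\}$ agree with those of $\mathbf S$ on $S\setminus\{e^{\mathbf S}\}$ and with those of $\mathbf A$ on $A$, and for $s\in S\setminus\{e^{\mathbf S}\}$, $a\in A$: $a\star s=s\star a=a$ if $e^{\mathbf S}\star^{\mathbf S}s=e^{\mathbf S}$, and $a\star s=s\star a=e^{\mathbf S}\star^{\mathbf S}s$ otherwise. $\prod_i\mathbf X_i/\mathcal U$ denotes the ultraproduct. -}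

module Defs where

open import Level using (0ℓ)
open import Data.Product using (Σ; _,_; proj₁; proj₂; _×_)
open import Data.Sum using (_⊎_; inj₁; inj₂)
open import Data.Empty using (⊥; ⊥-elim)
open import Data.Unit using (⊤; tt)
open import Relation.Nullary using (¬_)
open import Relation.Binary using (Rel; IsEquivalence)
open import Algebra.Core using (Op₁; Op₂)
import Algebra.Definitions as AD
import Algebra.Structures as AS
import Algebra.Lattice.Structures as LS
open import Function using (id)

-- Algebras of the signature ⟨ · , ∧ , ∨ , ¬ , e ⟩, over a setoid
-- (setoids are needed since ultraproducts are quotients).

record Raw : Set₁ where
  infixl 7 _·_
  infixl 6 _∧_
  infixl 5 _∨_
  infix 4 _≈_ _≤_
  field
    Carrier       : Set
    _≈_           : Rel Carrier 0ℓ
    isEquivalence : IsEquivalence _≈_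
    _·_ _∧_ _∨_   : Op₂ Carrier
    neg           : Op₁ Carrier
    e             : Carrier

  open IsEquivalence isEquivalence public

  _≤_ : Rel Carrier 0ℓ
  x ≤ y = (x ∧ y) ≈ x

  f : Carrier
  f = neg e

record IsIRL (A : Raw) : Set where
  open Raw A
  field
    ·-isCommutativeMonoid : AS.IsCommutativeMonoid _≈_ _·_ e
    isLattice             : LS.IsLattice _≈_ _∨_ _∧_
    neg-cong              : ∀ {x y} → x ≈ y → neg x ≈ neg y
    neg-involutive        : ∀ x → neg (neg x) ≈ x
    residuation           : ∀ x y z →
                              ((x · y ≤ z → neg z · y ≤ neg x) ×
                               (neg z · y ≤ neg x → x · y ≤ z))

record IsDeMorgan (A : Raw) : Set where
  open Raw A
  field
    isIRL            : IsIRL A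
    ∨-distrib-∧      : AD._DistributesOver_ _≈_ _∨_ _∧_
    ∧-distrib-∨      : AD._DistributesOver_ _≈_ _∧_ _∨_
    square-increasing : ∀ x → x ≤ x · x

  open IsIRL isIRL public

  isDistributiveLattice : LS.IsDistributiveLattice _≈_ _∨_ _∧_
  isDistributiveLattice = record
    { isLattice = isLattice ; ∨-distrib-∧ = ∨-distrib-∧ ; ∧-distrib-∨ = ∧-distrib-∨ }

record IsSugihara (A : Raw) : Set where
  open Raw A
  field
    isDeMorgan : IsDeMorgan A
    idempotent : ∀ x → x · x ≈ x

  open IsDeMorgan isDeMorgan public

IsOdd : Raw → Set
IsOdd A = f ≈ e where open Raw A

IsTotallyOrdered : Raw → Set
IsTotallyOrdered A = ∀ x y → (x ≤ y) ⊎ (y ≤ x) where open Raw A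

record TOSM : Set₁ where
  field
    raw          : Raw
    isSugihara   : IsSugihara raw
    odd          : IsOdd raw
    totallyOrdered : IsTotallyOrdered raw

  open Raw raw public
  open IsSugihara isSugihara public

record IsHom (A B : Raw) (h : Raw.Carrier A → Raw.Carrier B) : Set where
  private
    module A = Raw A
    module B = Raw B
  field
    cong  : ∀ {x y} → x A.≈ y → h x B.≈ h y
    hom-· : ∀ x y → h (x A.· y) B.≈ h x B.· h y
    hom-∧ : ∀ x y → h (x A.∧ y) B.≈ h x B.∧ h y
    hom-∨ : ∀ x y → h (x A.∨ y) B.≈ h x B.∨ h y
    hom-¬ : ∀ x → h (A.neg x) B.≈ B.neg (h x)
    hom-e : h A.e B.≈ B.e

-- embedding = injective homomorphism (i.e. isomorphism onto a subalgebra)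
record IsEmbedding (A B : Raw) (h : Raw.Carrier A → Raw.Carrier B) : Set where
  field
    isHom     : IsHom A B h
    injective : ∀ {x y} → Raw._≈_ B (h x) (h y) → Raw._≈_ A x y

  open IsHom isHom public

record _≅_ (A B : Raw) : Set where
  field
    to        : Raw.Carrier A → Raw.Carrier B
    from      : Raw.Carrier B → Raw.Carrier A
    to-isHom   : IsHom A B to
    from-isHom : IsHom B A from
    from∘to   : ∀ x → Raw._≈_ A (from (to x)) x
    to∘from   : ∀ y → Raw._≈_ B (to (from y)) y

module _ (S : TOSM) where
  private module S = TOSM S

  S⁻ : Set
  S⁻ = Σ S.Carrier (λ s → ¬ (s S.≈ S.e))

  private
    ∧c = LS.IsLattice.∧-cong S.isLattice
    ∨c = LS.IsLattice.∨-cong S.isLattice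
    ∧comm = LS.IsLattice.∧-comm S.isLattice
    ∨comm = LS.IsLattice.∨-comm S.isLattice
    ∨abs = LS.IsLattice.∨-absorbs-∧ S.isLattice
    cm = S.·-isCommutativeMonoid
    ·c = AS.IsCommutativeMonoid.∙-cong cm
    ·assoc = AS.IsCommutativeMonoid.assoc cm
    ·idl = AS.IsCommutativeMonoid.identityˡ cm
    ·idr = AS.IsCommutativeMonoid.identityʳ cm

    ≤⇒∨ : ∀ {x y} → x S.≤ y → (x S.∨ y) S.≈ y
    ≤⇒∨ {x} {y} p = S.trans (∨c (S.sym p') S.refl) (S.trans (∨comm _ _) (∨abs y x))
      where p' : (y S.∧ x) S.≈ x
            p' = S.trans (∧comm y x) p

  neg-ne : ∀ {s} → ¬ (s S.≈ S.e) → ¬ (S.neg s S.≈ S.e)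
  neg-ne {s} p q = p (S.trans (S.sym (S.neg-involutive s))
                       (S.trans (S.neg-cong q) S.odd))

  ∧-ne : ∀ {s t} → ¬ (s S.≈ S.e) → ¬ (t S.≈ S.e) → ¬ ((s S.∧ t) S.≈ S.e)
  ∧-ne {s} {t} p q r with S.totallyOrdered s t
  ... | inj₁ s≤t = p (S.trans (S.sym s≤t) r)
  ... | inj₂ t≤s = q (S.trans (S.sym t≤s) (S.trans (∧comm t s) r))

  ∨-ne : ∀ {s t} → ¬ (s S.≈ S.e) → ¬ (t S.≈ S.e) → ¬ ((s S.∨ t) S.≈ S.e)
  ∨-ne {s} {t} p q r with S.totallyOrdered s t
  ... | inj₁ s≤t = q (S.trans (S.sym (≤⇒∨ s≤t)) r)
  ... | inj₂ t≤s = p (S.trans (S.sym (≤⇒∨ t≤s)) (S.trans (∨comm t s) r))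

  ·-ne : ∀ {s t} → ¬ (s S.≈ S.e) → ¬ (t S.≈ S.e) → ¬ ((s S.· t) S.≈ S.e)
  ·-ne {s} {t} p q r = p
    (S.trans (S.sym (·idr s))
    (S.trans (·c S.refl (S.sym r))
    (S.trans (S.sym (·assoc s s t))
    (S.trans (·c (S.idempotent s) S.refl) r))))

  e∧-ne : ∀ {s} → s S.≤ S.e → ¬ (s S.≈ S.e) → ¬ ((S.e S.∧ s) S.≈ S.e)
  e∧-ne {s} le p r = p (S.trans (S.sym le) (S.trans (∧comm s S.e) r))

  e∨-ne : ∀ {s} → S.e S.≤ s → ¬ (s S.≈ S.e) → ¬ ((S.e S.∨ s) S.≈ S.e)
  e∨-ne {s} le p r = p (S.trans (S.sym (≤⇒∨ le)) r)

  e·-ne : ∀ {s} → ¬ (s S.≈ S.e) → ¬ ((S.e S.· s) S.≈ S.e)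
  e·-ne {s} p r = p (S.trans (S.sym (·idl s)) r)

  module _ (A : Raw) where
    private module A = Raw A

    ExtCarrier : Set
    ExtCarrier = S⁻ ⊎ A.Carrier

    _≈ₑ_ : Rel ExtCarrier 0ℓ
    inj₁ (s , _) ≈ₑ inj₁ (t , _) = s S.≈ t
    inj₂ a ≈ₑ inj₂ b = a A.≈ b
    _ ≈ₑ _ = ⊥

    private
      ≈ₑ-refl : ∀ {x} → x ≈ₑ x
      ≈ₑ-refl {inj₁ _} = S.refl
      ≈ₑ-refl {inj₂ _} = A.refl
      ≈ₑ-sym : ∀ {x y} → x ≈ₑ y → y ≈ₑ x
      ≈ₑ-sym {inj₁ _} {inj₁ _} p = S.sym p
      ≈ₑ-sym {inj₂ _} {inj₂ _} p = A.sym p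
      ≈ₑ-trans : ∀ {x y z} → x ≈ₑ y → y ≈ₑ z → x ≈ₑ z
      ≈ₑ-trans {inj₁ _} {inj₁ _} {inj₁ _} p q = S.trans p q
      ≈ₑ-trans {inj₂ _} {inj₂ _} {inj₂ _} p q = A.trans p q

    -- a ⋆ s = s ⋆ a  (s ∈ S∖{e}, a ∈ A):  a if e ⋆ s = e, and e ⋆ s otherwise.
    -- Whether e ⋆ s = e is decided by comparing s with e in the chain S.
    mix-∧ : S⁻ → A.Carrier → ExtCarrier
    mix-∧ (s , p) a with S.totallyOrdered S.e s
    ... | inj₁ _   = inj₂ a                                -- e ≤ s, so e ∧ s = e
    ... | inj₂ s≤e = inj₁ (S.e S.∧ s , e∧-ne s≤e p)        -- e ∧ s = s ≠ e

    mix-∨ : S⁻ → A.Carrier → ExtCarrier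
    mix-∨ (s , p) a with S.totallyOrdered S.e s
    ... | inj₁ e≤s = inj₁ (S.e S.∨ s , e∨-ne e≤s p)        -- e ∨ s = s ≠ e
    ... | inj₂ _   = inj₂ a                                -- s ≤ e, so e ∨ s = e

    mix-· : S⁻ → A.Carrier → ExtCarrier
    mix-· (s , p) a = inj₁ (S.e S.· s , e·-ne p)           -- e · s = s ≠ e

    _∧ₑ_ : Op₂ ExtCarrier
    inj₁ (s , p) ∧ₑ inj₁ (t , q) = inj₁ (s S.∧ t , ∧-ne p q)
    inj₁ s ∧ₑ inj₂ a = mix-∧ s a
    inj₂ a ∧ₑ inj₁ s = mix-∧ s a
    inj₂ a ∧ₑ inj₂ b = inj₂ (a A.∧ b)

    _∨ₑ_ : Op₂ ExtCarrier
    inj₁ (s , p) ∨ₑ inj₁ (t , q) = inj₁ (s S.∨ t , ∨-ne p q)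
    inj₁ s ∨ₑ inj₂ a = mix-∨ s a
    inj₂ a ∨ₑ inj₁ s = mix-∨ s a
    inj₂ a ∨ₑ inj₂ b = inj₂ (a A.∨ b)

    _·ₑ_ : Op₂ ExtCarrier
    inj₁ (s , p) ·ₑ inj₁ (t , q) = inj₁ (s S.· t , ·-ne p q)
    inj₁ s ·ₑ inj₂ a = mix-· s a
    inj₂ a ·ₑ inj₁ s = mix-· s a
    inj₂ a ·ₑ inj₂ b = inj₂ (a A.· b)

    negₑ : Op₁ ExtCarrier
    negₑ (inj₁ (s , p)) = inj₁ (S.neg s , neg-ne p)
    negₑ (inj₂ a) = inj₂ (A.neg a)

    _[_] : Raw
    _[_] = record
      { Carrier = ExtCarrier
      ; _≈_ = _≈ₑ_
      ; isEquivalence = record { refl = λ {x} → ≈ₑ-refl {x} ; sym = λ {x} {y} → ≈ₑ-sym {x} {y} ; trans = λ {x} {y} {z} → ≈ₑ-trans {x} {y} {z} }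
      ; _·_ = _·ₑ_
      ; _∧_ = _∧ₑ_
      ; _∨_ = _∨ₑ_
      ; neg = negₑ
      ; e = inj₂ A.e
      }

extMap : (S P : TOSM) (A B : Raw)
         (g : TOSM.Carrier S → TOSM.Carrier P) →
         (∀ s → ¬ (TOSM._≈_ S s (TOSM.e S)) → ¬ (TOSM._≈_ P (g s) (TOSM.e P))) →
         (h : Raw.Carrier A → Raw.Carrier B) →
         Raw.Carrier (S [ A ]) → Raw.Carrier (P [ B ])
extMap S P A B g g-ne h (inj₁ (s , p)) = inj₁ (g s , g-ne s p)
extMap S P A B g g-ne h (inj₂ a) = inj₂ (h a)

emb-ne : (P S : TOSM) {g : TOSM.Carrier P → TOSM.Carrier S} →
         IsEmbedding (TOSM.raw P) (TOSM.raw S) g →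
         ∀ s → ¬ (TOSM._≈_ P s (TOSM.e P)) → ¬ (TOSM._≈_ S (g s) (TOSM.e S))
emb-ne P S emb s p q = p (IsEmbedding.injective emb
  (TOSM.trans S q (TOSM.sym S (IsEmbedding.hom-e emb))))

record Ultrafilter (I : Set) : Set₁ where
  field
    _∈U : (I → Set) → Set
    univ   : (λ _ → ⊤) ∈U
    proper : ¬ ((λ _ → ⊥) ∈U)
    upward : ∀ {X Y : I → Set} → X ∈U → (∀ i → X i → Y i) → Y ∈U
    ∩-closed : ∀ {X Y : I → Set} → X ∈U → Y ∈U → (λ i → X i × Y i) ∈U
    ultra  : ∀ (X : I → Set) → X ∈U ⊎ (λ i → ¬ X i) ∈U

module _ {I : Set} (U : Ultrafilter I) where
  open Ultrafilter U

  private
    all : ∀ {X : I → Set} → (∀ i → X i) → X ∈U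
    all p = upward univ (λ i _ → p i)

    map₂ : ∀ {X Y Z : I → Set} → (∀ i → X i → Y i → Z i) → X ∈U → Y ∈U → Z ∈U
    map₂ f p q = upward (∩-closed p q) (λ i xy → f i (proj₁ xy) (proj₂ xy))

    map₃ : ∀ {X Y Z W : I → Set} → (∀ i → X i → Y i → Z i → W i) →
           X ∈U → Y ∈U → Z ∈U → W ∈U
    map₃ f p q r = upward (∩-closed p (∩-closed q r))
                     (λ i xyz → f i (proj₁ xyz) (proj₁ (proj₂ xyz)) (proj₂ (proj₂ xyz)))

  Ultraproduct : (I → Raw) → Raw
  Ultraproduct R = record
    { Carrier = (i : I) → Raw.Carrier (R i)
    ; _≈_ = λ x y → (λ i → Raw._≈_ (R i) (x i) (y i)) ∈U
    ; isEquivalence = record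
        { refl = all (λ i → Raw.refl (R i))
        ; sym = λ p → upward p (λ i → Raw.sym (R i))
        ; trans = map₂ (λ i → Raw.trans (R i)) }
    ; _·_ = λ x y i → Raw._·_ (R i) (x i) (y i)
    ; _∧_ = λ x y i → Raw._∧_ (R i) (x i) (y i)
    ; _∨_ = λ x y i → Raw._∨_ (R i) (x i) (y i)
    ; neg = λ x i → Raw.neg (R i) (x i)
    ; e = λ i → Raw.e (R i)
    }

  UltraproductTOSM : (I → TOSM) → TOSM
  UltraproductTOSM S = record
    { raw = P
    ; isSugihara = record
        { isDeMorgan = record
            { isIRL = record
                { ·-isCommutativeMonoid = record
                    { isMonoid = record
                        { isSemigroup = record
                            { isMagma = record
                                { isEquivalence = P.isEquivalence
                                ; ∙-cong = λ {x} {y} {u} {v} → map₂ (λ i → AS.IsCommutativeMonoid.∙-cong (cm i) {x i} {y i} {u i} {v i}) }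
                            ; assoc = λ x y z → all (λ i → ·assoc i (x i) (y i) (z i)) }
                        ; identity = (λ x → all (λ i → ·idl i (x i)))
                                   , (λ x → all (λ i → ·idr i (x i))) }
                    ; comm = λ x y → all (λ i → ·comm i (x i) (y i)) }
                ; isLattice = record
                    { isEquivalence = P.isEquivalence
                    ; ∨-comm = λ x y → all (λ i → L.∨-comm i (x i) (y i))
                    ; ∨-assoc = λ x y z → all (λ i → L.∨-assoc i (x i) (y i) (z i))
                    ; ∨-cong = λ {x} {y} {u} {v} → map₂ (λ i → L.∨-cong i {x i} {y i} {u i} {v i})
                    ; ∧-comm = λ x y → all (λ i → L.∧-comm i (x i) (y i))
                    ; ∧-assoc = λ x y z → all (λ i → L.∧-assoc i (x i) (y i) (z i))
                    ; ∧-cong = λ {x} {y} {u} {v} → map₂ (λ i → L.∧-cong i {x i} {y i} {u i} {v i})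
                    ; absorptive = (λ x y → all (λ i → L.∨-absorbs-∧ i (x i) (y i)))
                                 , (λ x y → all (λ i → L.∧-absorbs-∨ i (x i) (y i))) }
                ; neg-cong = λ {x} {y} p → upward p (λ i → TOSM.neg-cong (S i) {x i} {y i})
                ; neg-involutive = λ x → all (λ i → TOSM.neg-involutive (S i) (x i))
                ; residuation = λ x y z →
                    (λ p → upward p (λ i → proj₁ (TOSM.residuation (S i) (x i) (y i) (z i))))
                  , (λ p → upward p (λ i → proj₂ (TOSM.residuation (S i) (x i) (y i) (z i))))
                }
            ; ∨-distrib-∧ = (λ x y z → all (λ i → proj₁ (TOSM.∨-distrib-∧ (S i)) (x i) (y i) (z i)))
                          , (λ x y z → all (λ i → proj₂ (TOSM.∨-distrib-∧ (S i)) (x i) (y i) (z i)))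
            ; ∧-distrib-∨ = (λ x y z → all (λ i → proj₁ (TOSM.∧-distrib-∨ (S i)) (x i) (y i) (z i)))
                          , (λ x y z → all (λ i → proj₂ (TOSM.∧-distrib-∨ (S i)) (x i) (y i) (z i)))
            ; square-increasing = λ x → all (λ i → TOSM.square-increasing (S i) (x i))
            }
        ; idempotent = λ x → all (λ i → TOSM.idempotent (S i) (x i))
        }
    ; odd = all (λ i → TOSM.odd (S i))
    ; totallyOrdered = tot
    }
    where
      P = Ultraproduct (λ i → TOSM.raw (S i))
      module P = Raw P
      module L (i : I) = LS.IsLattice (TOSM.isLattice (S i))
      cm : (i : I) → _
      cm i = TOSM.·-isCommutativeMonoid (S i)
      ·assoc = λ i → AS.IsCommutativeMonoid.assoc (cm i)
      ·idl = λ i → AS.IsCommutativeMonoid.identityˡ (cm i)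
      ·idr = λ i → AS.IsCommutativeMonoid.identityʳ (cm i)
      ·comm = λ i → AS.IsCommutativeMonoid.comm (cm i)
      tot : IsTotallyOrdered P
      tot x y with ultra (λ i → TOSM._≤_ (S i) (x i) (y i))
      ... | inj₁ p = inj₁ p
      ... | inj₂ q = inj₂ (upward q (λ i nle → lemma i nle))
        where
          lemma : ∀ i → ¬ TOSM._≤_ (S i) (x i) (y i) → TOSM._≤_ (S i) (y i) (x i)
          lemma i nle with TOSM.totallyOrdered (S i) (x i) (y i)
          ... | inj₁ le = ⊥-elim (nle le)
          ... | inj₂ le = le

-- In S[A] an operation is computed inside S∖{e} or inside A, except for the mixed pairs,
-- where s ∧ a is s if s < e and a otherwise, dually for ∨, and s · a = s.  A homomorphism of
-- chains preserves the position of s relative to e, which gives (1) and (2).  For (3), an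
-- element of ∏(Sᵢ[Aᵢ])/U has U-almost all of its components in the A-parts or U-almost all
-- in the S∖{e}-parts, which relates it to a unique element of (∏Sᵢ/U)[∏Aᵢ/U]; this relation
-- is compatible with the operations because s ≤ e holds in ∏Sᵢ/U exactly when sᵢ ≤ e for
-- U-almost all i.
module Submission where

open import Defs
open import Data.Product using (∃; _×_; _,_; proj₁; proj₂)
open import Data.Sum using (_⊎_; inj₁; inj₂; [_,_]′)
open import Data.Empty using (⊥; ⊥-elim)
open import Data.Unit using (⊤; tt)
open import Relation.Nullary using (¬_)
open import Relation.Binary.PropositionalEquality as ≡ using (_≡_)
open import Function using (id)
import Algebra.Structures as AS
import Algebra.Lattice.Structures as LS

module LatticeOrder (A : Raw) (isLattice : LS.IsLattice (Raw._≈_ A) (Raw._∨_ A) (Raw._∧_ A)) where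
  open Raw A
  open LS.IsLattice isLattice using (∧-cong; ∧-comm)

  ≤-antisym : ∀ {x y} → x ≤ y → y ≤ x → x ≈ y
  ≤-antisym {x} {y} x≤y y≤x = trans (sym x≤y) (trans (∧-comm x y) y≤x)

  ≤-resp-≈ : ∀ {x x′ y y′} → x ≈ x′ → y ≈ y′ → x ≤ y → x′ ≤ y′
  ≤-resp-≈ x≈x′ y≈y′ x≤y =
    trans (∧-cong (sym x≈x′) (sym y≈y′)) (trans x≤y x≈x′)

module _ {A B : Raw} {h : Raw.Carrier A → Raw.Carrier B} (isHom : IsHom A B h)
         (B-isLattice : LS.IsLattice (Raw._≈_ B) (Raw._∨_ B) (Raw._∧_ B)) where
  private
    module A = Raw A
    module B = Raw B
    open IsHom isHom
    open LatticeOrder B B-isLattice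

  hom-mono : ∀ {x y} → x A.≤ y → h x B.≤ h y
  hom-mono {x} {y} x≤y = B.trans (B.sym (hom-∧ x y)) (cong x≤y)

  hom-e≤ : ∀ {x} → A.e A.≤ x → B.e B.≤ h x
  hom-e≤ e≤x = ≤-resp-≈ hom-e B.refl (hom-mono e≤x)

  hom-≤e : ∀ {x} → x A.≤ A.e → h x B.≤ B.e
  hom-≤e x≤e = ≤-resp-≈ B.refl hom-e (hom-mono x≤e)

module MixedOperations (S : TOSM) (A : Raw) where
  open TOSM S using (raw; isLattice; totallyOrdered; _≈_; _≤_; _∧_; _∨_; e)
  open LatticeOrder raw isLattice

  mix-∧-above : ∀ {s} (q : ¬ s ≈ e) a → e ≤ s → mix-∧ S A (s , q) a ≡ inj₂ a
  mix-∧-above {s} q a e≤s with totallyOrdered e s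
  ... | inj₁ _   = ≡.refl
  ... | inj₂ s≤e = ⊥-elim (q (≤-antisym s≤e e≤s))

  -- The proof that e ∧ s ≉ e stored in the result is the one mix-∧ builds, hence the ∃.
  mix-∧-below : ∀ {s} (q : ¬ s ≈ e) a → s ≤ e →
                ∃ λ q′ → mix-∧ S A (s , q) a ≡ inj₁ (e ∧ s , q′)
  mix-∧-below {s} q a s≤e with totallyOrdered e s
  ... | inj₁ e≤s = ⊥-elim (q (≤-antisym s≤e e≤s))
  ... | inj₂ _   = _ , ≡.refl

  mix-∨-above : ∀ {s} (q : ¬ s ≈ e) a → e ≤ s →
                ∃ λ q′ → mix-∨ S A (s , q) a ≡ inj₁ (e ∨ s , q′)
  mix-∨-above {s} q a e≤s with totallyOrdered e s
  ... | inj₁ _   = _ , ≡.refl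
  ... | inj₂ s≤e = ⊥-elim (q (≤-antisym s≤e e≤s))

  mix-∨-below : ∀ {s} (q : ¬ s ≈ e) a → s ≤ e → mix-∨ S A (s , q) a ≡ inj₂ a
  mix-∨-below {s} q a s≤e with totallyOrdered e s
  ... | inj₁ e≤s = ⊥-elim (q (≤-antisym s≤e e≤s))
  ... | inj₂ _   = ≡.refl

module _ (S T : TOSM) (A B : Raw)
         (g : TOSM.Carrier S → TOSM.Carrier T)
         (g-ne : ∀ s → ¬ TOSM._≈_ S s (TOSM.e S) → ¬ TOSM._≈_ T (g s) (TOSM.e T))
         (h : Raw.Carrier A → Raw.Carrier B) where
  private
    module S = TOSM S
    module T = TOSM T
    module SA = Raw (S [ A ])
    module TB = Raw (T [ B ])
    module ST = MixedOperations T B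
    open LS.IsLattice T.isLattice using (∧-cong; ∨-cong)

    φ : SA.Carrier → TB.Carrier
    φ = extMap S T A B g g-ne h

  extMap-injective : (∀ {s t} → g s T.≈ g t → s S.≈ t) →
                     (∀ {a b} → Raw._≈_ B (h a) (h b) → Raw._≈_ A a b) →
                     ∀ {x y} → φ x TB.≈ φ y → x SA.≈ y
  extMap-injective g-inj h-inj {inj₁ _} {inj₁ _} = g-inj
  extMap-injective g-inj h-inj {inj₂ _} {inj₂ _} = h-inj

  module _ (g-hom : IsHom S.raw T.raw g) (h-hom : IsHom A B h) where
    private
      module G = IsHom g-hom
      module H = IsHom h-hom
      ·-cong = AS.IsCommutativeMonoid.∙-cong T.·-isCommutativeMonoid

    extMap-cong : ∀ {x y} → x SA.≈ y → φ x TB.≈ φ y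
    extMap-cong {inj₁ _} {inj₁ _} = G.cong
    extMap-cong {inj₂ _} {inj₂ _} = H.cong

    extMap-mix-∧ : ∀ s a →
                   φ (mix-∧ S A s a) TB.≈ mix-∧ T B (g (proj₁ s) , g-ne _ (proj₂ s)) (h a)
    extMap-mix-∧ (s , q) a with S.totallyOrdered S.e s
    ... | inj₁ e≤s rewrite ST.mix-∧-above (g-ne s q) (h a) (hom-e≤ g-hom T.isLattice e≤s) =
      Raw.refl B
    ... | inj₂ s≤e with ST.mix-∧-below (g-ne s q) (h a) (hom-≤e g-hom T.isLattice s≤e)
    ...   | _ , eq rewrite eq = T.trans (G.hom-∧ S.e s) (∧-cong G.hom-e T.refl)

    extMap-mix-∨ : ∀ s a →
                   φ (mix-∨ S A s a) TB.≈ mix-∨ T B (g (proj₁ s) , g-ne _ (proj₂ s)) (h a)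
    extMap-mix-∨ (s , q) a with S.totallyOrdered S.e s
    ... | inj₂ s≤e rewrite ST.mix-∨-below (g-ne s q) (h a) (hom-≤e g-hom T.isLattice s≤e) =
      Raw.refl B
    ... | inj₁ e≤s with ST.mix-∨-above (g-ne s q) (h a) (hom-e≤ g-hom T.isLattice e≤s)
    ...   | _ , eq rewrite eq = T.trans (G.hom-∨ S.e s) (∨-cong G.hom-e T.refl)

    extMap-mix-· : ∀ s a →
                   φ (mix-· S A s a) TB.≈ mix-· T B (g (proj₁ s) , g-ne _ (proj₂ s)) (h a)
    extMap-mix-· (s , _) _ = T.trans (G.hom-· S.e s) (·-cong G.hom-e T.refl)

    extMap-isHom : IsHom (S [ A ]) (T [ B ]) φ
    extMap-isHom = record
      { cong  = λ {x} {y} → extMap-cong {x} {y}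
      ; hom-· = hom-·
      ; hom-∧ = hom-∧
      ; hom-∨ = hom-∨
      ; hom-¬ = hom-¬
      ; hom-e = H.hom-e
      }
      where
        hom-· : ∀ x y → φ (x SA.· y) TB.≈ φ x TB.· φ y
        hom-· (inj₁ (s , _)) (inj₁ (t , _)) = G.hom-· s t
        hom-· (inj₁ s)       (inj₂ a)       = extMap-mix-· s a
        hom-· (inj₂ a)       (inj₁ s)       = extMap-mix-· s a
        hom-· (inj₂ a)       (inj₂ b)       = H.hom-· a b

        hom-∧ : ∀ x y → φ (x SA.∧ y) TB.≈ φ x TB.∧ φ y
        hom-∧ (inj₁ (s , _)) (inj₁ (t , _)) = G.hom-∧ s t
        hom-∧ (inj₁ s)       (inj₂ a)       = extMap-mix-∧ s a
        hom-∧ (inj₂ a)       (inj₁ s)       = extMap-mix-∧ s a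
        hom-∧ (inj₂ a)       (inj₂ b)       = H.hom-∧ a b

        hom-∨ : ∀ x y → φ (x SA.∨ y) TB.≈ φ x TB.∨ φ y
        hom-∨ (inj₁ (s , _)) (inj₁ (t , _)) = G.hom-∨ s t
        hom-∨ (inj₁ s)       (inj₂ a)       = extMap-mix-∨ s a
        hom-∨ (inj₂ a)       (inj₁ s)       = extMap-mix-∨ s a
        hom-∨ (inj₂ a)       (inj₂ b)       = H.hom-∨ a b

        hom-¬ : ∀ x → φ (SA.neg x) TB.≈ TB.neg (φ x)
        hom-¬ (inj₁ (s , _)) = G.hom-¬ s
        hom-¬ (inj₂ a)       = H.hom-¬ a

id-isHom : (A : Raw) → IsHom A A id
id-isHom A = record
  { cong  = id
  ; hom-· = λ _ _ → refl
  ; hom-∧ = λ _ _ → refl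
  ; hom-∨ = λ _ _ → refl
  ; hom-¬ = λ _ → refl
  ; hom-e = refl
  }
  where open Raw A using (refl)

extMap-isEmbedding : (S T : TOSM) (A B : Raw) {g : TOSM.Carrier S → TOSM.Carrier T}
                     (g-emb : IsEmbedding (TOSM.raw S) (TOSM.raw T) g) →
                     {h : Raw.Carrier A → Raw.Carrier B} → IsEmbedding A B h →
                     IsEmbedding (S [ A ]) (T [ B ]) (extMap S T A B g (emb-ne S T g-emb) h)
extMap-isEmbedding S T A B {g} g-emb {h} h-emb = record
  { isHom     = extMap-isHom S T A B g (emb-ne S T g-emb) h
                  (IsEmbedding.isHom g-emb) (IsEmbedding.isHom h-emb)
  ; injective = λ {x} {y} → extMap-injective S T A B g (emb-ne S T g-emb) h
                              (IsEmbedding.injective g-emb) (IsEmbedding.injective h-emb) {x} {y}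
  }

module UltrafilterProperties {I : Set} (U : Ultrafilter I) where
  open Ultrafilter U

  ∈U-all : ∀ {X : I → Set} → (∀ i → X i) → X ∈U
  ∈U-all x = upward univ (λ i _ → x i)

  upward₂ : ∀ {X Y Z : I → Set} → (∀ i → X i → Y i → Z i) → X ∈U → Y ∈U → Z ∈U
  upward₂ f x y = upward (∩-closed x y) (λ i (xᵢ , yᵢ) → f i xᵢ yᵢ)

  upward₃ : ∀ {X Y Z W : I → Set} → (∀ i → X i → Y i → Z i → W i) →
            X ∈U → Y ∈U → Z ∈U → W ∈U
  upward₃ f x y z =
    upward (∩-closed x (∩-closed y z)) (λ i (xᵢ , yᵢ , zᵢ) → f i xᵢ yᵢ zᵢ)

  ∈U-split : ∀ {X Y : I → Set} → (λ i → X i × Y i) ∈U → X ∈U × Y ∈U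
  ∈U-split xy = upward xy (λ _ → proj₁) , upward xy (λ _ → proj₂)

  ∈U-nonempty : ∀ {X : I → Set} → X ∈U → ¬ (∀ i → ¬ X i)
  ∈U-nonempty x empty = proper (upward x empty)

  ∉U⇒complement∈U : ∀ {X : I → Set} → ¬ X ∈U → (λ i → ¬ X i) ∈U
  ∉U⇒complement∈U {X} X∉U with ultra X
  ... | inj₁ X∈U = ⊥-elim (X∉U X∈U)
  ... | inj₂ ¬X∈U = ¬X∈U

  weak-excluded-middle : (P : Set) → ¬ P ⊎ ¬ ¬ P
  weak-excluded-middle P with ultra (λ _ → P)
  ... | inj₁ p  = inj₂ (λ ¬p → ∈U-nonempty p (λ _ → ¬p))
  ... | inj₂ ¬p = inj₁ (λ p → ∈U-nonempty ¬p (λ _ ¬p → ¬p p))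

module _ (A B : Raw) where
  private
    module A = Raw A
    module B = Raw B

  record Correspondence : Set₁ where
    infix 4 _∼_
    field
      _∼_          : A.Carrier → B.Carrier → Set
      left-total   : ∀ x → ∃ (x ∼_)
      right-total  : ∀ y → ∃ (_∼ y)
      ∼-functional : ∀ {x y y′} → x ∼ y → x ∼ y′ → y B.≈ y′
      ∼-injective  : ∀ {x x′ y} → x ∼ y → x′ ∼ y → x A.≈ x′
      ∼-respˡ      : ∀ {x x′ y} → x A.≈ x′ → x ∼ y → x′ ∼ y
      ∼-respʳ      : ∀ {x y y′} → y B.≈ y′ → x ∼ y → x ∼ y′
      ∼-·          : ∀ {x x′ y y′} → x ∼ y → x′ ∼ y′ → x A.· x′ ∼ y B.· y′
      ∼-∧          : ∀ {x x′ y y′} → x ∼ y → x′ ∼ y′ → x A.∧ x′ ∼ y B.∧ y′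
      ∼-∨          : ∀ {x x′ y y′} → x ∼ y → x′ ∼ y′ → x A.∨ x′ ∼ y B.∨ y′
      ∼-neg        : ∀ {x y} → x ∼ y → A.neg x ∼ B.neg y
      ∼-e          : A.e ∼ B.e

  Correspondence⇒≅ : Correspondence → A ≅ B
  Correspondence⇒≅ R = record
    { to         = to
    ; from       = from
    ; to-isHom   = record
      { cong  = λ x≈x′ → ∼-functional (∼-respˡ x≈x′ (∼-to _)) (∼-to _)
      ; hom-· = λ x x′ → ∼-functional (∼-to _) (∼-· (∼-to x) (∼-to x′))
      ; hom-∧ = λ x x′ → ∼-functional (∼-to _) (∼-∧ (∼-to x) (∼-to x′))
      ; hom-∨ = λ x x′ → ∼-functional (∼-to _) (∼-∨ (∼-to x) (∼-to x′))
      ; hom-¬ = λ x → ∼-functional (∼-to _) (∼-neg (∼-to x))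
      ; hom-e = ∼-functional (∼-to _) ∼-e
      }
    ; from-isHom = record
      { cong  = λ y≈y′ → ∼-injective (∼-respʳ y≈y′ (from-∼ _)) (from-∼ _)
      ; hom-· = λ y y′ → ∼-injective (from-∼ _) (∼-· (from-∼ y) (from-∼ y′))
      ; hom-∧ = λ y y′ → ∼-injective (from-∼ _) (∼-∧ (from-∼ y) (from-∼ y′))
      ; hom-∨ = λ y y′ → ∼-injective (from-∼ _) (∼-∨ (from-∼ y) (from-∼ y′))
      ; hom-¬ = λ y → ∼-injective (from-∼ _) (∼-neg (from-∼ y))
      ; hom-e = ∼-injective (from-∼ _) ∼-e
      }
    ; from∘to    = λ x → ∼-injective (from-∼ _) (∼-to x)
    ; to∘from    = λ y → ∼-functional (∼-to _) (from-∼ y)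
    }
    where
      open Correspondence R
      to : A.Carrier → B.Carrier
      to x = proj₁ (left-total x)
      ∼-to : ∀ x → x ∼ to x
      ∼-to x = proj₂ (left-total x)
      from : B.Carrier → A.Carrier
      from y = proj₁ (right-total y)
      from-∼ : ∀ y → from y ∼ y
      from-∼ y = proj₂ (right-total y)

module Components (S : TOSM) (A : Raw) (A-isIRL : IsIRL A) where
  private
    module S = TOSM S
    module A = Raw A
    module E = Raw (S [ A ])
    module SL = LS.IsLattice S.isLattice
    module AL = LS.IsLattice (IsIRL.isLattice A-isIRL)
    open MixedOperations S A
    open LatticeOrder S.raw S.isLattice
    S·-cong = AS.IsCommutativeMonoid.∙-cong S.·-isCommutativeMonoid
    A·-cong = AS.IsCommutativeMonoid.∙-cong (IsIRL.·-isCommutativeMonoid A-isIRL)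

  infix 4 _≈ˢ_ _≈ᵃ_

  _≈ˢ_ : E.Carrier → S.Carrier → Set
  inj₁ (t , _) ≈ˢ s = t S.≈ s
  inj₂ _       ≈ˢ _ = ⊥

  _≈ᵃ_ : E.Carrier → A.Carrier → Set
  inj₁ _ ≈ᵃ _ = ⊥
  inj₂ b ≈ᵃ a = b A.≈ a

  ≈ˢ-injective : ∀ u v {s} → u ≈ˢ s → v ≈ˢ s → u E.≈ v
  ≈ˢ-injective (inj₁ _) (inj₁ _) us vs = S.trans us (S.sym vs)

  ≈ᵃ-injective : ∀ u v {a} → u ≈ᵃ a → v ≈ᵃ a → u E.≈ v
  ≈ᵃ-injective (inj₂ _) (inj₂ _) ua va = A.trans ua (A.sym va)

  ≈ˢ-functional : ∀ u {s t} → u ≈ˢ s → u ≈ˢ t → s S.≈ t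
  ≈ˢ-functional (inj₁ _) us ut = S.trans (S.sym us) ut

  ≈ᵃ-functional : ∀ u {a b} → u ≈ᵃ a → u ≈ᵃ b → a A.≈ b
  ≈ᵃ-functional (inj₂ _) ua ub = A.trans (A.sym ua) ub

  ≈ˢ-≈ᵃ-disjoint : ∀ u {s a} → u ≈ˢ s → ¬ u ≈ᵃ a
  ≈ˢ-≈ᵃ-disjoint (inj₁ _) _ ()

  ≈ˢ-respˡ : ∀ u v {s} → u E.≈ v → u ≈ˢ s → v ≈ˢ s
  ≈ˢ-respˡ (inj₁ _) (inj₁ _) u≈v us = S.trans (S.sym u≈v) us

  ≈ᵃ-respˡ : ∀ u v {a} → u E.≈ v → u ≈ᵃ a → v ≈ᵃ a
  ≈ᵃ-respˡ (inj₂ _) (inj₂ _) u≈v ua = A.trans (A.sym u≈v) ua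

  ≈ˢ-respʳ : ∀ u {s t} → s S.≈ t → u ≈ˢ s → u ≈ˢ t
  ≈ˢ-respʳ (inj₁ _) s≈t us = S.trans us s≈t

  ≈ᵃ-respʳ : ∀ u {a b} → a A.≈ b → u ≈ᵃ a → u ≈ᵃ b
  ≈ᵃ-respʳ (inj₂ _) a≈b ua = A.trans ua a≈b

  ∧-≈ˢ : ∀ u v {s t} → u ≈ˢ s → v ≈ˢ t → u E.∧ v ≈ˢ s S.∧ t
  ∧-≈ˢ (inj₁ _) (inj₁ _) = SL.∧-cong

  ∨-≈ˢ : ∀ u v {s t} → u ≈ˢ s → v ≈ˢ t → u E.∨ v ≈ˢ s S.∨ t
  ∨-≈ˢ (inj₁ _) (inj₁ _) = SL.∨-cong

  ·-≈ˢ : ∀ u v {s t} → u ≈ˢ s → v ≈ˢ t → u E.· v ≈ˢ s S.· t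
  ·-≈ˢ (inj₁ _) (inj₁ _) = S·-cong

  neg-≈ˢ : ∀ u {s} → u ≈ˢ s → E.neg u ≈ˢ S.neg s
  neg-≈ˢ (inj₁ _) = S.neg-cong

  ∧-≈ᵃ : ∀ u v {a b} → u ≈ᵃ a → v ≈ᵃ b → u E.∧ v ≈ᵃ a A.∧ b
  ∧-≈ᵃ (inj₂ _) (inj₂ _) = AL.∧-cong

  ∨-≈ᵃ : ∀ u v {a b} → u ≈ᵃ a → v ≈ᵃ b → u E.∨ v ≈ᵃ a A.∨ b
  ∨-≈ᵃ (inj₂ _) (inj₂ _) = AL.∨-cong

  ·-≈ᵃ : ∀ u v {a b} → u ≈ᵃ a → v ≈ᵃ b → u E.· v ≈ᵃ a A.· b
  ·-≈ᵃ (inj₂ _) (inj₂ _) = A·-cong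

  neg-≈ᵃ : ∀ u {a} → u ≈ᵃ a → E.neg u ≈ᵃ A.neg a
  neg-≈ᵃ (inj₂ _) = IsIRL.neg-cong A-isIRL

  ∧-mixed-above : ∀ u v {s a} → u ≈ˢ s → v ≈ᵃ a → S.e S.≤ s →
                  u E.∧ v ≈ᵃ a × v E.∧ u ≈ᵃ a
  ∧-mixed-above (inj₁ (t , q)) (inj₂ b) t≈s b≈a e≤s
    rewrite mix-∧-above q b (≤-resp-≈ S.refl (S.sym t≈s) e≤s) = b≈a , b≈a

  ∧-mixed-below : ∀ u v {s a} → u ≈ˢ s → v ≈ᵃ a → s S.≤ S.e →
                  u E.∧ v ≈ˢ S.e S.∧ s × v E.∧ u ≈ˢ S.e S.∧ s
  ∧-mixed-below (inj₁ (t , q)) (inj₂ b) t≈s _ s≤e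
    with mix-∧-below q b (≤-resp-≈ (S.sym t≈s) S.refl s≤e)
  ... | _ , eq rewrite eq = SL.∧-cong S.refl t≈s , SL.∧-cong S.refl t≈s

  ∨-mixed-above : ∀ u v {s a} → u ≈ˢ s → v ≈ᵃ a → S.e S.≤ s →
                  u E.∨ v ≈ˢ S.e S.∨ s × v E.∨ u ≈ˢ S.e S.∨ s
  ∨-mixed-above (inj₁ (t , q)) (inj₂ b) t≈s _ e≤s
    with mix-∨-above q b (≤-resp-≈ S.refl (S.sym t≈s) e≤s)
  ... | _ , eq rewrite eq = SL.∨-cong S.refl t≈s , SL.∨-cong S.refl t≈s

  ∨-mixed-below : ∀ u v {s a} → u ≈ˢ s → v ≈ᵃ a → s S.≤ S.e →
                  u E.∨ v ≈ᵃ a × v E.∨ u ≈ᵃ a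
  ∨-mixed-below (inj₁ (t , q)) (inj₂ b) t≈s b≈a s≤e
    rewrite mix-∨-below q b (≤-resp-≈ (S.sym t≈s) S.refl s≤e) = b≈a , b≈a

  ·-mixed : ∀ u v {s a} → u ≈ˢ s → v ≈ᵃ a →
            u E.· v ≈ˢ S.e S.· s × v E.· u ≈ˢ S.e S.· s
  ·-mixed (inj₁ _) (inj₂ _) t≈s _ = S·-cong S.refl t≈s , S·-cong S.refl t≈s

  FromA : E.Carrier → Set
  FromA (inj₁ _) = ⊥
  FromA (inj₂ _) = ⊤

  projˢ : E.Carrier → S.Carrier
  projˢ (inj₁ (s , _)) = s
  projˢ (inj₂ _)       = S.e

  projᵃ : E.Carrier → A.Carrier
  projᵃ (inj₁ _) = A.e
  projᵃ (inj₂ a) = a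

  projˢ-≈ˢ : ∀ u → ¬ FromA u → u ≈ˢ projˢ u
  projˢ-≈ˢ (inj₁ _) _   = S.refl
  projˢ-≈ˢ (inj₂ _) ¬fa = ⊥-elim (¬fa tt)

  projˢ-≉e : ∀ u → ¬ FromA u → ¬ projˢ u S.≈ S.e
  projˢ-≉e (inj₁ (_ , q)) _   = q
  projˢ-≉e (inj₂ _)       ¬fa = ⊥-elim (¬fa tt)

  projᵃ-≈ᵃ : ∀ u → FromA u → u ≈ᵃ projᵃ u
  projᵃ-≈ᵃ (inj₂ _) _ = A.refl

  fromˢ : (s : S.Carrier) → ¬ s S.≈ S.e ⊎ ¬ ¬ s S.≈ S.e → E.Carrier
  fromˢ s (inj₁ q) = inj₁ (s , q)
  fromˢ s (inj₂ _) = inj₂ A.e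

  fromˢ-≈ˢ : ∀ s d → ¬ s S.≈ S.e → fromˢ s d ≈ˢ s
  fromˢ-≈ˢ s (inj₁ _)  _ = S.refl
  fromˢ-≈ˢ s (inj₂ ¬¬q) q = ⊥-elim (¬¬q q)

module _ {I : Set} (U : Ultrafilter I) (S : I → TOSM) (A : I → Raw)
         (A-isIRL : ∀ i → IsIRL (A i)) where
  private
    open Ultrafilter U
    open UltrafilterProperties U
    module C (i : I) = Components (S i) (A i) (A-isIRL i)
    module Sᵢ (i : I) = TOSM (S i)
    module Aᵢ (i : I) = Raw (A i)
    ∏S = UltraproductTOSM U S
    ∏A = Ultraproduct U A
    module ∏S = TOSM ∏S
    module Src = Raw (Ultraproduct U (λ i → S i [ A i ]))
    module Tgt = Raw (∏S [ ∏A ])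
    open MixedOperations ∏S ∏A

    infix 4 _∼_
    _∼_ : Src.Carrier → Tgt.Carrier → Set
    x ∼ inj₁ (s , _) = (λ i → C._≈ˢ_ i (x i) (s i)) ∈U
    x ∼ inj₂ a       = (λ i → C._≈ᵃ_ i (x i) (a i)) ∈U

    ∼-disjoint : ∀ {x s a} → x ∼ inj₁ s → ¬ x ∼ inj₂ a
    ∼-disjoint {x} xs xa =
      ∈U-nonempty (∩-closed xs xa) (λ i (xsᵢ , xaᵢ) → C.≈ˢ-≈ᵃ-disjoint i (x i) xsᵢ xaᵢ)

    ∼-functional : ∀ {x y y′} → x ∼ y → x ∼ y′ → y Tgt.≈ y′
    ∼-functional {x} {inj₁ _} {inj₁ _} = upward₂ (λ i → C.≈ˢ-functional i (x i))
    ∼-functional {x} {inj₂ _} {inj₂ _} = upward₂ (λ i → C.≈ᵃ-functional i (x i))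
    ∼-functional {x} {inj₁ s} {inj₂ a} xs xa = ⊥-elim (∼-disjoint {x} {s} {a} xs xa)
    ∼-functional {x} {inj₂ a} {inj₁ s} xa xs = ⊥-elim (∼-disjoint {x} {s} {a} xs xa)

    ∼-injective : ∀ {x x′ y} → x ∼ y → x′ ∼ y → x Src.≈ x′
    ∼-injective {x} {x′} {inj₁ _} = upward₂ (λ i → C.≈ˢ-injective i (x i) (x′ i))
    ∼-injective {x} {x′} {inj₂ _} = upward₂ (λ i → C.≈ᵃ-injective i (x i) (x′ i))

    ∼-respˡ : ∀ {x x′ y} → x Src.≈ x′ → x ∼ y → x′ ∼ y
    ∼-respˡ {x} {x′} {inj₁ _} = upward₂ (λ i → C.≈ˢ-respˡ i (x i) (x′ i))
    ∼-respˡ {x} {x′} {inj₂ _} = upward₂ (λ i → C.≈ᵃ-respˡ i (x i) (x′ i))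

    ∼-respʳ : ∀ {x y y′} → y Tgt.≈ y′ → x ∼ y → x ∼ y′
    ∼-respʳ {x} {inj₁ _} {inj₁ _} = upward₂ (λ i → C.≈ˢ-respʳ i (x i))
    ∼-respʳ {x} {inj₂ _} {inj₂ _} = upward₂ (λ i → C.≈ᵃ-respʳ i (x i))

    ∧-mixed : ∀ {x x′ s a} (q : ¬ s ∏S.≈ ∏S.e) → x ∼ inj₁ (s , q) → x′ ∼ inj₂ a →
              x Src.∧ x′ ∼ mix-∧ ∏S ∏A (s , q) a ×
              x′ Src.∧ x ∼ mix-∧ ∏S ∏A (s , q) a
    ∧-mixed {x} {x′} {s} {a} q xs x′a = [ above , below ]′ (∏S.totallyOrdered ∏S.e s)
      where
        Both : Tgt.Carrier → Set
        Both t = x Src.∧ x′ ∼ t × x′ Src.∧ x ∼ t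
        above : ∏S.e ∏S.≤ s → Both (mix-∧ ∏S ∏A (s , q) a)
        above e≤s = ≡.subst Both (≡.sym (mix-∧-above q a e≤s))
                      (∈U-split (upward₃ (λ i → C.∧-mixed-above i (x i) (x′ i))
                                         xs x′a e≤s))
        below : s ∏S.≤ ∏S.e → Both (mix-∧ ∏S ∏A (s , q) a)
        below s≤e = ≡.subst Both (≡.sym (proj₂ (mix-∧-below q a s≤e)))
                      (∈U-split (upward₃ (λ i → C.∧-mixed-below i (x i) (x′ i))
                                         xs x′a s≤e))

    ∨-mixed : ∀ {x x′ s a} (q : ¬ s ∏S.≈ ∏S.e) → x ∼ inj₁ (s , q) → x′ ∼ inj₂ a →
              x Src.∨ x′ ∼ mix-∨ ∏S ∏A (s , q) a ×
              x′ Src.∨ x ∼ mix-∨ ∏S ∏A (s , q) a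
    ∨-mixed {x} {x′} {s} {a} q xs x′a = [ above , below ]′ (∏S.totallyOrdered ∏S.e s)
      where
        Both : Tgt.Carrier → Set
        Both t = x Src.∨ x′ ∼ t × x′ Src.∨ x ∼ t
        above : ∏S.e ∏S.≤ s → Both (mix-∨ ∏S ∏A (s , q) a)
        above e≤s = ≡.subst Both (≡.sym (proj₂ (mix-∨-above q a e≤s)))
                      (∈U-split (upward₃ (λ i → C.∨-mixed-above i (x i) (x′ i))
                                         xs x′a e≤s))
        below : s ∏S.≤ ∏S.e → Both (mix-∨ ∏S ∏A (s , q) a)
        below s≤e = ≡.subst Both (≡.sym (mix-∨-below q a s≤e))
                      (∈U-split (upward₃ (λ i → C.∨-mixed-below i (x i) (x′ i))
                                         xs x′a s≤e))

    ∼-∧ : ∀ {x x′ y y′} → x ∼ y → x′ ∼ y′ → x Src.∧ x′ ∼ y Tgt.∧ y′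
    ∼-∧ {x} {x′} {inj₁ _}       {inj₁ _}       = upward₂ (λ i → C.∧-≈ˢ i (x i) (x′ i))
    ∼-∧ {x} {x′} {inj₂ _}       {inj₂ _}       = upward₂ (λ i → C.∧-≈ᵃ i (x i) (x′ i))
    ∼-∧ {x} {x′} {inj₁ (_ , q)} {inj₂ _}       xs x′a = proj₁ (∧-mixed {x} {x′} q xs x′a)
    ∼-∧ {x} {x′} {inj₂ _}       {inj₁ (_ , q)} xa x′s = proj₂ (∧-mixed {x′} {x} q x′s xa)

    ∼-∨ : ∀ {x x′ y y′} → x ∼ y → x′ ∼ y′ → x Src.∨ x′ ∼ y Tgt.∨ y′
    ∼-∨ {x} {x′} {inj₁ _}       {inj₁ _}       = upward₂ (λ i → C.∨-≈ˢ i (x i) (x′ i))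
    ∼-∨ {x} {x′} {inj₂ _}       {inj₂ _}       = upward₂ (λ i → C.∨-≈ᵃ i (x i) (x′ i))
    ∼-∨ {x} {x′} {inj₁ (_ , q)} {inj₂ _}       xs x′a = proj₁ (∨-mixed {x} {x′} q xs x′a)
    ∼-∨ {x} {x′} {inj₂ _}       {inj₁ (_ , q)} xa x′s = proj₂ (∨-mixed {x′} {x} q x′s xa)

    ∼-· : ∀ {x x′ y y′} → x ∼ y → x′ ∼ y′ → x Src.· x′ ∼ y Tgt.· y′
    ∼-· {x} {x′} {inj₁ _} {inj₁ _} = upward₂ (λ i → C.·-≈ˢ i (x i) (x′ i))
    ∼-· {x} {x′} {inj₂ _} {inj₂ _} = upward₂ (λ i → C.·-≈ᵃ i (x i) (x′ i))
    ∼-· {x} {x′} {inj₁ _} {inj₂ _} =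
      upward₂ (λ i xs x′a → proj₁ (C.·-mixed i (x i) (x′ i) xs x′a))
    ∼-· {x} {x′} {inj₂ _} {inj₁ _} =
      upward₂ (λ i xa x′s → proj₂ (C.·-mixed i (x′ i) (x i) x′s xa))

    ∼-neg : ∀ {x y} → x ∼ y → Src.neg x ∼ Tgt.neg y
    ∼-neg {x} {inj₁ _} xs = upward xs (λ i → C.neg-≈ˢ i (x i))
    ∼-neg {x} {inj₂ _} xa = upward xa (λ i → C.neg-≈ᵃ i (x i))

    left-total : ∀ x → ∃ (x ∼_)
    left-total x with ultra (λ i → C.FromA i (x i))
    ... | inj₁ fromA  =
      inj₂ (λ i → C.projᵃ i (x i)) , upward fromA (λ i → C.projᵃ-≈ᵃ i (x i))
    ... | inj₂ ¬fromA =
      inj₁ ((λ i → C.projˢ i (x i)) , ≉e) , upward ¬fromA (λ i → C.projˢ-≈ˢ i (x i))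
      where
        ≉e : ¬ (λ i → C.projˢ i (x i)) ∏S.≈ ∏S.e
        ≉e ≈e = ∈U-nonempty (∩-closed ≈e ¬fromA)
                  (λ i (≈eᵢ , ¬fromAᵢ) → C.projˢ-≉e i (x i) ¬fromAᵢ ≈eᵢ)

    -- A preimage of s ∈ ∏S∖{e} must decide at every index whether s i ≈ e. The ultrafilter only
    -- decides this up to double negation, which suffices: the choice is right wherever s i ≉ e.
    right-total : ∀ y → ∃ (_∼ y)
    right-total (inj₁ (s , q)) =
      (λ i → C.fromˢ i (s i) (decide i)) ,
      upward (∉U⇒complement∈U q) (λ i → C.fromˢ-≈ˢ i (s i) (decide i))
      where
        decide : ∀ i → ¬ Sᵢ._≈_ i (s i) (Sᵢ.e i) ⊎ ¬ ¬ Sᵢ._≈_ i (s i) (Sᵢ.e i)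
        decide i = weak-excluded-middle _
    right-total (inj₂ a) = (λ i → inj₂ (a i)) , ∈U-all (λ i → Aᵢ.refl i)

  ultraproduct-extension-≅ :
    Ultraproduct U (λ i → S i [ A i ]) ≅ (UltraproductTOSM U S [ Ultraproduct U A ])
  ultraproduct-extension-≅ = Correspondence⇒≅ _ _ record
    { _∼_          = _∼_
    ; left-total   = left-total
    ; right-total  = right-total
    ; ∼-functional = λ {x} {y} {y′} → ∼-functional {x} {y} {y′}
    ; ∼-injective  = λ {x} {x′} {y} → ∼-injective {x} {x′} {y}
    ; ∼-respˡ      = λ {x} {x′} {y} → ∼-respˡ {x} {x′} {y}
    ; ∼-respʳ      = λ {x} {y} {y′} → ∼-respʳ {x} {y} {y′}
    ; ∼-·          = λ {x} {x′} {y} {y′} → ∼-· {x} {x′} {y} {y′}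
    ; ∼-∧          = λ {x} {x′} {y} {y′} → ∼-∧ {x} {x′} {y} {y′}
    ; ∼-∨          = λ {x} {x′} {y} {y′} → ∼-∨ {x} {x′} {y} {y′}
    ; ∼-neg        = λ {x} {y} → ∼-neg {x} {y}
    ; ∼-e          = ∈U-all (λ i → Aᵢ.refl i)
    }

theorem7p20 :
    ((S : TOSM) (A B : Raw) → IsDeMorgan A → IsDeMorgan B →
      (h : Raw.Carrier A → Raw.Carrier B) → IsHom A B h →
      IsHom (S [ A ]) (S [ B ]) (extMap S S A B id (λ _ p → p) h)
      × (∀ a → Raw._≈_ (S [ B ]) (extMap S S A B id (λ _ p → p) h (inj₂ a)) (inj₂ (h a))))
    ×
    ((S P : TOSM) (A B : Raw) → IsDeMorgan A → IsDeMorgan B →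
      (g : TOSM.Carrier P → TOSM.Carrier S) →
      (gE : IsEmbedding (TOSM.raw P) (TOSM.raw S) g) →
      (k : Raw.Carrier B → Raw.Carrier A) → IsEmbedding B A k →
      IsEmbedding (P [ B ]) (S [ A ]) (extMap P S B A g (emb-ne P S gE) k))
    ×
    ((I : Set) (S : I → TOSM) (A : I → Raw) → (∀ i → IsDeMorgan (A i)) →
      (U : Ultrafilter I) →
      Ultraproduct U (λ i → S i [ A i ]) ≅ (UltraproductTOSM U S [ Ultraproduct U A ]))
theorem7p20 =
    (λ S A B _ _ h h-hom →
       extMap-isHom S S A B id (λ _ p → p) h (id-isHom (TOSM.raw S)) h-hom , λ _ → Raw.refl B)
  , (λ S P A B _ _ g g-emb k k-emb → extMap-isEmbedding P S B A g-emb k-emb)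
  , (λ I S A A-isDeMorgan U →
       ultraproduct-extension-≅ U S A (λ i → IsDeMorgan.isIRL (A-isDeMorgan i)))
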